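{- Let $e_1$ be an odd integer with $e_1>1$, let $e_2=e_1$, and let $P=\{\{a^{e_1}\},\{\hat a^{e_2}\},\{\hat a\}\}$. Then $P$ realizes a graph of order $n$ for every $n\in 2\mathbb{Z}_{\ge 0}$.
   Context: Graphs are loopless multigraphs; the order of a graph is its number of vertices. A tile is a vertex with half-edges (cohesive ends) labeled by letters; $\{a^{e}\}$ denotes a tile with $e$ cohesive ends of type $a$, and $\{\hat a^{e}\}$ a tile with $e$ cohesive ends of the complementary type $\hat a$. A pot is a set of tile types. A graph $G$ is realized by a pot $P$ if each vertex $v$ can be assigned a tile type $t\in P$ together with a bijection between the cohesive ends of $t$ and the edge-ends (half-edges) at $v$, such that for every edge the two half-edges are assigned complementary cohesive ends ($a$ and $\hat a$). -}

module Defs where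

open import Data.Nat using (ℕ)
open import Data.Bool using (Bool; true; false; _≟_)
open import Data.Fin using (Fin)
open import Data.List using (List; []; _∷_; length; lookup; replicate)
open import Data.List.Membership.Propositional using (_∈_)
open import Data.Product using (Σ; _×_; _,_; proj₁; proj₂)
open import Relation.Binary.PropositionalEquality using (_≡_; _≢_; refl)
open import Function.Bundles using (_↔_; Inverse)

-- A cohesive end: a bond-type letter (letters encoded as natural numbers)
-- together with a flag saying whether it is hatted (â) or not (a).
record CohesiveEnd : Set where
  constructor end
  field
    letter : ℕ
    hatted : Bool
open CohesiveEnd public

Complementary : CohesiveEnd → CohesiveEnd → Set
Complementary x y = letter x ≡ letter y × hatted x ≢ hatted y

-- A tile is a (multi)set of cohesive ends, listed; its cohesive ends are
-- indexed by Fin (length t).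
Tile : Set
Tile = List CohesiveEnd

Pot : Set
Pot = List Tile

-- Loopless multigraph of order n: vertices Fin n, m edges, edge i has
-- endpoints (ends i); repeated edges are allowed, loops are not.
record Graph (n : ℕ) : Set where
  field
    m        : ℕ
    ends     : Fin m → Fin n × Fin n
    loopless : (i : Fin m) → proj₁ (ends i) ≢ proj₂ (ends i)

module _ {n : ℕ} (G : Graph n) where
  open Graph G

  HalfEdge : Set
  HalfEdge = Fin m × Bool

  endpoint : HalfEdge → Fin n
  endpoint (i , false) = proj₁ (ends i)
  endpoint (i , true)  = proj₂ (ends i)

  HalfEdgeAt : Fin n → Set
  HalfEdgeAt v = Σ HalfEdge (λ h → endpoint h ≡ v)

Realizes : Pot → {n : ℕ} → Graph n → Set
Realizes P {n} G =
  Σ (Fin n → Tile) λ tile →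
  ((v : Fin n) → tile v ∈ P) ×
  Σ ((v : Fin n) → Fin (length (tile v)) ↔ HalfEdgeAt G v) λ φ →
    let endAt : (h : HalfEdge G) → CohesiveEnd
        endAt h = lookup (tile (endpoint G h)) (Inverse.from (φ (endpoint G h)) (h , refl))
    in (i : Fin (Graph.m G)) → Complementary (endAt (i , false)) (endAt (i , true))

a : ℕ
a = 0

aTile : ℕ → Tile
aTile e = replicate e (end a false)

âTile : ℕ → Tile
âTile e = replicate e (end a true)

pot : ℕ → ℕ → Pot
pot e₁ e₂ = aTile e₁ ∷ âTile e₂ ∷ âTile 1 ∷ []

{-# OPTIONS --safe #-}
-- The graph is k disjoint copies of the dipole with e parallel edges.  In
-- each dipole one vertex carries {a^e} and the other {â^e}, so every edge
-- joins an a-end to an â-end.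
module Submission where

open import Defs
open import Data.Nat using (ℕ; _+_; _*_; _<_)
open import Data.Bool using (Bool; true; false)
open import Data.Fin using (Fin; combine; remQuot; _≟_)
open import Data.Fin.Properties using (2↔Bool; combine-remQuot; remQuot-combine)
open import Data.List using (length; lookup; replicate)
open import Data.List.Properties using (length-replicate)
open import Data.List.Membership.Propositional using (_∈_)
open import Data.List.Membership.Propositional.Properties using (∈-lookup)
open import Data.List.Relation.Unary.Any using (here; there)
import Data.List.Relation.Unary.All as All
open import Data.List.Relation.Unary.All.Properties using (replicate⁺)
open import Data.Product using (Σ; ∃; _,_; proj₁; proj₂)
open import Function.Bundles using (_↔_; Inverse; mk↔ₛ′)
open import Axiom.UniquenessOfIdentityProofs using (module Decidable⇒UIP)
open import Relation.Binary.PropositionalEquality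
  using (_≡_; _≢_; refl; sym; trans; cong; cong₂; subst; module ≡-Reasoning)

lookup-replicate-any : ∀ {A : Set} n (x : A) i → lookup (replicate n x) i ≡ x
lookup-replicate-any n x i = All.lookup {P = _≡ x} (replicate⁺ n refl) (∈-lookup i)

module Dipoles (k e : ℕ) where

  open Inverse 2↔Bool using () renaming (to to fromFin2; from to toFin2)

  vertex : Bool → Fin k → Fin (2 * k)
  vertex b p = combine (toFin2 b) p

  side : Fin (2 * k) → Bool
  side v = fromFin2 (proj₁ (remQuot {2} k v))

  copyOf : Fin (2 * k) → Fin k
  copyOf v = proj₂ (remQuot {2} k v)

  side-vertex : ∀ b p → side (vertex b p) ≡ b
  side-vertex b p = trans (cong (λ z → fromFin2 (proj₁ z)) (remQuot-combine (toFin2 b) p))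
                          (Inverse.strictlyInverseˡ 2↔Bool b)

  copyOf-vertex : ∀ b p → copyOf (vertex b p) ≡ p
  copyOf-vertex b p = cong proj₂ (remQuot-combine (toFin2 b) p)

  vertex-side-copyOf : ∀ v → vertex (side v) (copyOf v) ≡ v
  vertex-side-copyOf v =
    trans (cong (λ s → combine s (copyOf v)) (Inverse.strictlyInverseʳ 2↔Bool (proj₁ (remQuot {2} k v))))
          (combine-remQuot {2} k v)

  vertex-injectiveˡ : ∀ b c p q → vertex b p ≡ vertex c q → b ≡ c
  vertex-injectiveˡ b c p q eq = trans (sym (side-vertex b p)) (trans (cong side eq) (side-vertex c q))

  edge : Fin k → Fin e → Fin (k * e)
  edge = combine

  copy : Fin (k * e) → Fin k
  copy i = proj₁ (remQuot {k} e i)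

  parallelIndex : Fin (k * e) → Fin e
  parallelIndex i = proj₂ (remQuot {k} e i)

  dipoles : Graph (2 * k)
  dipoles = record
    { m        = k * e
    ; ends     = λ i → vertex false (copy i) , vertex true (copy i)
    ; loopless = λ i eq → false≢true (vertex-injectiveˡ false true _ _ eq)
    }
    where
    false≢true : false ≢ true
    false≢true ()

  endpoint-vertex : ∀ h → endpoint dipoles h ≡ vertex (proj₂ h) (copy (proj₁ h))
  endpoint-vertex (i , false) = refl
  endpoint-vertex (i , true)  = refl

  halfEdgeAt-≡ : ∀ {v} {x y : HalfEdgeAt dipoles v} → proj₁ x ≡ proj₁ y → x ≡ y
  halfEdgeAt-≡ {x = h , p} {.h , q} refl = cong (h ,_) (Decidable⇒UIP.≡-irrelevant _≟_ p q)

  halfEdgesAt↔ : ∀ v → Fin e ↔ HalfEdgeAt dipoles v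
  halfEdgesAt↔ v = mk↔ₛ′ to from to-from from-to
    where
    to : Fin e → HalfEdgeAt dipoles v
    to j = (edge (copyOf v) j , side v) , (begin
      endpoint dipoles (edge (copyOf v) j , side v)  ≡⟨ endpoint-vertex (edge (copyOf v) j , side v) ⟩
      vertex (side v) (copy (edge (copyOf v) j))      ≡⟨ cong (λ z → vertex (side v) (proj₁ z)) (remQuot-combine (copyOf v) j) ⟩
      vertex (side v) (copyOf v)                      ≡⟨ vertex-side-copyOf v ⟩
      v                                               ∎)
      where open ≡-Reasoning

    from : HalfEdgeAt dipoles v → Fin e
    from ((i , _) , _) = parallelIndex i

    from-to : ∀ j → from (to j) ≡ j
    from-to j = cong proj₂ (remQuot-combine (copyOf v) j)

    to-from : ∀ h → to (from h) ≡ h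
    to-from ((i , b) , at-v) = halfEdgeAt-≡ (cong₂ _,_ same-edge same-side)
      where
      at-v′ : vertex b (copy i) ≡ v
      at-v′ = trans (sym (endpoint-vertex (i , b))) at-v

      same-edge : edge (copyOf v) (parallelIndex i) ≡ i
      same-edge = trans (cong (λ p → edge p (parallelIndex i))
                              (trans (cong copyOf (sym at-v′)) (copyOf-vertex b (copy i))))
                        (combine-remQuot {k} e i)

      same-side : side v ≡ b
      same-side = trans (cong side (sym at-v′)) (side-vertex b (copy i))

  tile : Fin (2 * k) → Tile
  tile v = replicate e (end a (side v))

  dipoles-realized : ∀ {P} → aTile e ∈ P → âTile e ∈ P → Realizes P dipoles
  dipoles-realized {P} a∈P â∈P =
    tile , tile∈P , φ , λ i → complementary (endAt-hatted (i , false)) (endAt-hatted (i , true))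
    where
    tile∈P : ∀ v → tile v ∈ P
    tile∈P v with side v
    ... | false = a∈P
    ... | true  = â∈P

    φ : ∀ v → Fin (length (tile v)) ↔ HalfEdgeAt dipoles v
    φ v = subst (λ n → Fin n ↔ HalfEdgeAt dipoles v) (sym (length-replicate e)) (halfEdgesAt↔ v)

    endAt-hatted : ∀ h → lookup (tile (endpoint dipoles h)) (Inverse.from (φ (endpoint dipoles h)) (h , refl))
                         ≡ end a (proj₂ h)
    endAt-hatted h = trans (lookup-replicate-any e _ _)
                           (cong (end a) (trans (cong side (endpoint-vertex h)) (side-vertex (proj₂ h) _)))

    complementary : ∀ {x y} → x ≡ end a false → y ≡ end a true → Complementary x y
    complementary refl refl = refl , λ ()

corollary1 : (e₁ : ℕ) → (∃ λ j → e₁ ≡ 1 + 2 * j) → 1 < e₁ →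
             (e₂ : ℕ) → e₂ ≡ e₁ →
             (k : ℕ) → Σ (Graph (2 * k)) (λ G → Realizes (pot e₁ e₂) G)
corollary1 e₁ _ _ .e₁ refl k = dipoles , dipoles-realized (here refl) (there (here refl))
  where open Dipoles k e₁
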